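{- Let $p$ be a prime with $p\equiv 1\pmod 4$ and for an integer $n\ge 0$ define $$F(n)=4^{p-1}\prod_{\substack{j=0\\ j\neq \frac{p-1}{4}}}^{p-1}(1+4j+4np)^2\prod_{i=0}^{p-2}\frac{1}{(1+i+np)^2}.$$ Then $F(0)\equiv 1\pmod{p^2}$.
   Context: $F(n)$ is a rational number whose denominator is prime to $p$. For such rationals $x,y$, $x\equiv y\pmod{p^k}$ means that $x-y$, in lowest terms, has numerator divisible by $p^k$. -}

module Defs where

open import Data.Nat using (ℕ; zero; suc; _+_; _*_; _∸_; _^_; _≟_)
open import Data.Nat.DivMod using (_/_)
open import Data.List using (List; upTo; filter; map; foldr)
open import Data.Integer using (ℤ; +_)
open import Data.Integer.Divisibility using () renaming (_∣_ to _∣ℤ_)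
open import Data.Rational using (ℚ; ↥_; 1ℚ) renaming (_*_ to _*ℚ_; _-_ to _-ℚ_; _/_ to _/ℚ_)
open import Relation.Nullary.Decidable using (¬?)

prodℚ : List ℚ → ℚ
prodℚ = foldr _*ℚ_ 1ℚ

ℕ→ℚ : ℕ → ℚ
ℕ→ℚ m = (+ m) /ℚ 1

sq : ℚ → ℚ
sq x = x *ℚ x

F : ℕ → ℕ → ℚ
F p n =
  ℕ→ℚ (4 ^ (p ∸ 1))
  *ℚ prodℚ (map (λ j → sq (ℕ→ℚ (1 + 4 * j + 4 * n * p)))
                (filter (λ j → ¬? (j ≟ (p ∸ 1) / 4)) (upTo p)))
  *ℚ prodℚ (map (λ i → sq ((+ 1) /ℚ suc (i + n * p))) (upTo (p ∸ 1)))

-- x ≡ y (mod p^k): numerator of x - y (in lowest terms) divisible by p^k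
_≡_[mod_^_] : ℚ → ℚ → ℕ → ℕ → Set
x ≡ y [mod p ^ k ] = (+ (p ^ k)) ∣ℤ (↥ (x -ℚ y))

module Submission where

open import Defs
open import Data.Nat using (ℕ; _%_)
open import Data.Nat.Primality using (Prime)
open import Data.Rational using (1ℚ)
open import Relation.Binary.PropositionalEquality using (_≡_)

open import Data.Nat as ℕ using (zero; suc; z≤n; s≤s; _≟_)
import Data.Nat.Properties as ℕₚ
import Data.Nat.Divisibility as ℕᵈ
open import Data.Nat.DivMod using (_/_; m*n/n≡m; m≡m%n+[m/n]*n)
open import Data.Nat.Primality using (euclidsLemma; prime⇒nonZero; ¬prime[1])
import Data.Nat.Tactic.RingSolver as ℕ-Solver
open import Data.Integer using (ℤ; +_; _+_; _*_; _-_; -_; _^_) renaming (∣_∣ to abs)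
open import Data.Integer.Properties
  using (*-identityˡ; *-identityʳ; *-assoc; *-zeroʳ; abs-*; pos-+; pos-*; *-cancelʳ-≡)
open import Data.Integer.Tactic.RingSolver using (solve-∀)
open import Data.Integer.Divisibility.Signed
open import Data.Rational as ℚ using (ℚ; toℚᵘ; ↥_; ↧_)
import Data.Rational.Properties as ℚₚ
open import Data.Rational.Unnormalised as ℚᵘ using (ℚᵘ; mkℚᵘ; 1ℚᵘ; *≡*; _≃_)
  renaming (↥_ to ↥ᵘ_; ↧_ to ↧ᵘ_)
import Data.Rational.Unnormalised.Properties as ℚᵘₚ
open import Data.List using (List; []; _∷_; _++_; [_]; map; reverse; length; foldr; filter; upTo; applyUpTo)
open import Data.List.Properties
  using (map-++; map-∘; map-cong; map-id; length-map; length-++; reverse-++; unfold-reverse;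
         ++-identityʳ; filter-accept; filter-reject)
open import Data.List.Relation.Binary.Pointwise using (Pointwise; []; _∷_; ++⁺; Pointwise-≡⇒≡)
open import Data.List.Relation.Unary.All as All using (All; []; _∷_)
open import Data.List.Relation.Unary.All.Properties using (map⁺)
open import Data.Product using (Σ; _,_)
open import Data.Sum using (_⊎_; inj₁; inj₂)
open import Data.Empty using (⊥-elim)
open import Function using (_∘_; id)
open import Relation.Nullary using (¬_)
open import Relation.Nullary.Decidable using (¬?)
open import Relation.Binary.PropositionalEquality hiding ([_])

-- For a prime p = 4t + 1 we show F(0) ≡ 1 (mod p²), where
-- F(0) = 4^(p-1) A² / ((p-1)!)² and A = ∏_{0 ≤ j < p, j ≠ t} (1 + 4j); that is,
-- (2^(p-1) A)² ≡ ((p-1)!)² (mod p²).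
--
-- Every congruence modulo p² comes from one principle (Π-shift-mod²): shifting
-- all entries of a list by a multiple of p changes its product only modulo p²
-- when p divides the cofactor sum ∂Π = Σᵢ ∏_{j≠i} xⱼ.  For an odd prime p this
-- sum vanishes modulo p on 1, …, p-1 and hence on the non-zero terms of any
-- progression 1 + dj, 0 ≤ j < p (∂Π-progression).  Comparing two factorisations
-- of (2p)! gives 2^(p-1) O ≡ (p-1)! for the odd numbers O below 2p (odds-mod²);
-- comparing two factorisations of the product of the odd numbers below 4p gives
-- A C = O O′ with C ≡ A and O′ ≡ O, so (2^(p-1) A)² ≡ ((p-1)!)² follows
-- (square-congruence).

Π : List ℤ → ℤ
Π []       = + 1
Π (x ∷ xs) = x * Π xs

-- The cofactor sum ∂Π xs = Σᵢ ∏_{j≠i} xⱼ, i.e. the elementary symmetric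
-- function of degree (length xs ∸ 1); it is the linear coefficient of
-- c ↦ Π (xs shifted by c), see Π-shift.
∂Π : List ℤ → ℤ
∂Π []       = + 0
∂Π (x ∷ xs) = Π xs + x * ∂Π xs

Π-++ : ∀ xs ys → Π (xs ++ ys) ≡ Π xs * Π ys
Π-++ []       ys = sym (*-identityˡ (Π ys))
Π-++ (x ∷ xs) ys = trans (cong (x *_) (Π-++ xs ys)) (sym (*-assoc x (Π xs) (Π ys)))

∂Π-++ : ∀ xs ys → ∂Π (xs ++ ys) ≡ Π xs * ∂Π ys + ∂Π xs * Π ys
∂Π-++ []       ys = ring (∂Π ys) (Π ys)
  where ring : ∀ s a → s ≡ + 1 * s + + 0 * a
        ring = solve-∀
∂Π-++ (x ∷ xs) ys rewrite Π-++ xs ys | ∂Π-++ xs ys = ring (Π xs) (Π ys) (∂Π xs) (∂Π ys) x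
  where ring : ∀ a b c d x → a * b + x * (a * d + c * b) ≡ (x * a) * d + (a + x * c) * b
        ring = solve-∀

∂Π-rotate : ∀ xs ys → ∂Π (xs ++ ys) ≡ ∂Π (ys ++ xs)
∂Π-rotate xs ys rewrite ∂Π-++ xs ys | ∂Π-++ ys xs = ring (Π xs) (Π ys) (∂Π xs) (∂Π ys)
  where ring : ∀ a b c d → a * d + c * b ≡ b * c + d * a
        ring = solve-∀

Π-reverse : ∀ xs → Π (reverse xs) ≡ Π xs
Π-reverse []       = refl
Π-reverse (x ∷ xs) rewrite unfold-reverse x xs | Π-++ (reverse xs) [ x ] | Π-reverse xs =
  ring x (Π xs)
  where ring : ∀ x a → a * (x * + 1) ≡ x * a
        ring = solve-∀

∂Π-reverse : ∀ xs → ∂Π (reverse xs) ≡ ∂Π xs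
∂Π-reverse []       = refl
∂Π-reverse (x ∷ xs)
  rewrite unfold-reverse x xs | ∂Π-++ (reverse xs) [ x ] | Π-reverse xs | ∂Π-reverse xs =
  ring x (Π xs) (∂Π xs)
  where ring : ∀ x a s → a * (+ 1 + x * + 0) + s * (x * + 1) ≡ a + x * s
        ring = solve-∀

Π-scale : ∀ d xs → Π (map (d *_) xs) ≡ d ^ length xs * Π xs
Π-scale d []       = refl
Π-scale d (x ∷ xs) rewrite Π-scale d xs = ring d x (d ^ length xs) (Π xs)
  where ring : ∀ d x e a → d * x * (e * a) ≡ d * e * (x * a)
        ring = solve-∀

∂Π-scale : ∀ d xs → ∂Π (map (d *_) xs) * d ≡ d ^ length xs * ∂Π xs
∂Π-scale d []       = ring d
  where ring : ∀ d → + 0 * d ≡ + 1 * + 0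
        ring = solve-∀
∂Π-scale d (x ∷ xs) = begin
  (Π dxs + d * x * ∂Π dxs) * d         ≡⟨ ring₁ (Π dxs) (∂Π dxs) d x ⟩
  Π dxs * d + d * x * (∂Π dxs * d)     ≡⟨ cong₂ (λ u v → u * d + d * x * v) (Π-scale d xs) (∂Π-scale d xs) ⟩
  e * Π xs * d + d * x * (e * ∂Π xs)   ≡⟨ ring₂ e (Π xs) (∂Π xs) d x ⟩
  d * e * (Π xs + x * ∂Π xs)           ∎
  where
  open ≡-Reasoning
  dxs : List ℤ
  dxs = map (d *_) xs
  e : ℤ
  e = d ^ length xs
  ring₁ : ∀ a s d x → (a + d * x * s) * d ≡ a * d + d * x * (s * d)
  ring₁ = solve-∀
  ring₂ : ∀ e a s d x → e * a * d + d * x * (e * s) ≡ d * e * (a + x * s)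
  ring₂ = solve-∀

Π-shift : ∀ c xs → Σ ℤ λ q → Π (map (_+ c) xs) ≡ Π xs + c * ∂Π xs + q * (c * c)
Π-shift c []       = + 0 , ring c
  where ring : ∀ c → + 1 ≡ + 1 + c * + 0 + + 0 * (c * c)
        ring = solve-∀
Π-shift c (x ∷ xs) with Π-shift c xs
... | q , eq rewrite eq = x * q + ∂Π xs + c * q , ring x c (Π xs) (∂Π xs) q
  where ring : ∀ x c a s q → (x + c) * (a + c * s + q * (c * c))
                        ≡ x * a + c * (a + x * s) + (x * q + s + c * q) * (c * c)
        ring = solve-∀

Π-square : ∀ xs → Π (map (λ x → x * x) xs) ≡ Π xs * Π xs
Π-square []       = refl
Π-square (x ∷ xs) rewrite Π-square xs = ring x (Π xs)
  where ring : ∀ a b → a * a * (b * b) ≡ a * b * (a * b)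
        ring = solve-∀

Π-ones : ∀ {A : Set} (xs : List A) → Π (map (λ _ → + 1) xs) ≡ + 1
Π-ones []       = refl
Π-ones (_ ∷ xs) = trans (*-identityˡ _) (Π-ones xs)

Congruentᴸ : ℤ → List ℤ → List ℤ → Set
Congruentᴸ m = Pointwise (λ x y → m ∣ x - y)

∣-linear : ∀ {m a b} x y → m ∣ a → m ∣ b → m ∣ x * a + y * b
∣-linear x y m∣a m∣b = ∣m∣n⇒∣m+n (∣n⇒∣m*n x m∣a) (∣n⇒∣m*n y m∣b)

∣-flip : ∀ {m x y} → m ∣ x - y → m ∣ y - x
∣-flip {m} {x} {y} m∣x-y = subst (m ∣_) (ring x y) (∣m⇒∣-m m∣x-y)
  where ring : ∀ x y → - (x - y) ≡ y - x
        ring = solve-∀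

Congruentᴸ-sym : ∀ {m xs ys} → Congruentᴸ m xs ys → Congruentᴸ m ys xs
Congruentᴸ-sym []         = []
Congruentᴸ-sym {xs = x ∷ _} {y ∷ _} (d ∷ ds) = ∣-flip {x = x} {y} d ∷ Congruentᴸ-sym ds

Π-cong : ∀ {m xs ys} → Congruentᴸ m xs ys → m ∣ Π xs - Π ys
Π-cong []                         = divides (+ 0) refl
Π-cong {m} {x ∷ xs} {y ∷ ys} (d ∷ ds) =
  subst (m ∣_) (ring x y (Π xs) (Π ys)) (∣-linear x (Π ys) (Π-cong ds) d)
  where ring : ∀ x y a b → x * (a - b) + b * (x - y) ≡ x * a - y * b
        ring = solve-∀

∂Π-cong : ∀ {m xs ys} → Congruentᴸ m xs ys → m ∣ ∂Π xs - ∂Π ys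
∂Π-cong []                         = divides (+ 0) refl
∂Π-cong {m} {x ∷ xs} {y ∷ ys} (d ∷ ds) =
  subst (m ∣_) (ring x y (Π xs) (Π ys) (∂Π xs) (∂Π ys))
    (∣m∣n⇒∣m+n (∣-linear (+ 1) x (Π-cong ds) (∂Π-cong ds)) (∣n⇒∣m*n (∂Π ys) d))
  where ring : ∀ x y a b s r → + 1 * (a - b) + x * (s - r) + r * (x - y) ≡ a + x * s - (b + y * r)
        ring = solve-∀

Π-shift-mod² : ∀ m k xs → m ∣ ∂Π xs → m * m ∣ Π (map (_+ k * m) xs) - Π xs
Π-shift-mod² m k xs (divides s ∂Π≡) with Π-shift (k * m) xs
... | q , expand = divides (k * s + q * k * k) (begin
  Π (map (_+ k * m) xs) - Π xs                                ≡⟨ cong (_- Π xs) expand ⟩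
  Π xs + k * m * ∂Π xs + q * (k * m * (k * m)) - Π xs        ≡⟨ cong (λ z → Π xs + k * m * z + q * (k * m * (k * m)) - Π xs) ∂Π≡ ⟩
  Π xs + k * m * (s * m) + q * (k * m * (k * m)) - Π xs      ≡⟨ ring (Π xs) k m s q ⟩
  (k * s + q * k * k) * (m * m)                               ∎)
  where
  open ≡-Reasoning
  ring : ∀ a k m s q → a + k * m * (s * m) + q * (k * m * (k * m)) - a ≡ (k * s + q * k * k) * (m * m)
  ring = solve-∀

square-congruence : ∀ {m} a c o o' e u → a * c ≡ o * o' →
                    m ∣ c - a → m ∣ o' - o → m ∣ e * o - u → m ∣ e * a * (e * a) - u * u
square-congruence {m} a c o o' e u ac≡oo' c≡a o'≡o eo≡u =
  subst (m ∣_) (sym (trans (ring e a c o o' u) (cong (λ z → rest + e * e * z) (trans (cong (_- o * o') ac≡oo') (x-x≡0 (o * o'))))))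
    (∣m∣n⇒∣m+n rest-divisible (divides (+ 0) (*-zeroʳ (e * e))))
  where
  rest : ℤ
  rest = - (e * e * a) * (c - a) + e * e * o * (o' - o) + (e * o + u) * (e * o - u)
  rest-divisible : m ∣ rest
  rest-divisible = ∣m∣n⇒∣m+n (∣m∣n⇒∣m+n (∣n⇒∣m*n (- (e * e * a)) c≡a) (∣n⇒∣m*n (e * e * o) o'≡o))
                             (∣n⇒∣m*n (e * o + u) eo≡u)
  ring : ∀ e a c o o' u → e * a * (e * a) - u * u
        ≡ - (e * e * a) * (c - a) + e * e * o * (o' - o) + (e * o + u) * (e * o - u) + e * e * (a * c - o * o')
  ring = solve-∀
  x-x≡0 : ∀ x → x - x ≡ + 0
  x-x≡0 = solve-∀

module _ {p : ℕ} (isPrime : Prime p) where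

  private
    P : ℤ
    P = + p

  euclid : ∀ a b → P ∣ a * b → P ∣ a ⊎ P ∣ b
  euclid a b P∣ab with euclidsLemma (abs a) (abs b) isPrime (subst (p ℕᵈ.∣_) (abs-* a b) (∣⇒∣ᵤ P∣ab))
  ... | inj₁ p∣a = inj₁ (∣ᵤ⇒∣ p∣a)
  ... | inj₂ p∣b = inj₂ (∣ᵤ⇒∣ p∣b)

  ∤Π : ∀ {xs} → All (λ x → ¬ P ∣ x) xs → ¬ P ∣ Π xs
  ∤Π []         P∣1 = ¬prime[1] (subst Prime (ℕᵈ.∣1⇒≡1 (∣⇒∣ᵤ P∣1)) isPrime)
  ∤Π {x ∷ xs} (P∤x ∷ P∤xs) P∣Π with euclid x (Π xs) P∣Π
  ... | inj₁ P∣x  = P∤x P∣x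
  ... | inj₂ P∣xs = ∤Π P∤xs P∣xs

  cancel-mod² : ∀ a c → ¬ P ∣ c → P * P ∣ a * c → P * P ∣ a
  cancel-mod² a c P∤c P²∣ac = from-P∣a (euclid a c (∣-trans (divides P refl) P²∣ac))
    where
    -- once a = q p, cancelling one p from p² ∣ q p c leaves p ∣ q c, hence p ∣ q.
    from-P∣q : ∀ q → a ≡ q * P → P ∣ q ⊎ P ∣ c → P * P ∣ a
    from-P∣q q a≡qP (inj₁ (divides r q≡rP)) =
      divides r (trans a≡qP (trans (cong (_* P) q≡rP) (*-assoc r P P)))
    from-P∣q q a≡qP (inj₂ P∣c) = ⊥-elim (P∤c P∣c)
    from-P∣a : P ∣ a ⊎ P ∣ c → P * P ∣ a
    from-P∣a (inj₁ (divides q a≡qP)) = from-P∣q q a≡qP (euclid q c P∣qc)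
      where
      swap : ∀ q P c → q * P * c ≡ q * c * P
      swap = solve-∀
      P∣qc : P ∣ q * c
      P∣qc = *-cancelʳ-∣ P {{prime⇒nonZero isPrime}}
               (subst (P * P ∣_) (trans (cong (_* c) a≡qP) (swap q P c)) P²∣ac)
    from-P∣a (inj₂ P∣c) = ⊥-elim (P∤c P∣c)

range : ℕ → ℕ → List ℕ
range a zero    = []
range a (suc n) = a ∷ range (suc a) n

range-++ : ∀ a n m → range a (n ℕ.+ m) ≡ range a n ++ range (a ℕ.+ n) m
range-++ a zero    m rewrite ℕₚ.+-identityʳ a = refl
range-++ a (suc n) m rewrite ℕₚ.+-suc a n = cong (a ∷_) (range-++ (suc a) n m)

length-range : ∀ a n → length (range a n) ≡ n
length-range a zero    = refl
length-range a (suc n) = cong suc (length-range (suc a) n)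

map-range-suc : ∀ {A : Set} (f : ℕ → A) a n → map f (range (suc a) n) ≡ map (f ∘ suc) (range a n)
map-range-suc f a zero    = refl
map-range-suc f a (suc n) = cong (f (suc a) ∷_) (map-range-suc f (suc a) n)

upTo≡range : ∀ n → upTo n ≡ range 0 n
upTo≡range n = trans (applyUpTo≡map id n) (map-id (range 0 n))
  where
  applyUpTo≡map : ∀ {A : Set} (f : ℕ → A) n → applyUpTo f n ≡ map f (range 0 n)
  applyUpTo≡map f zero    = refl
  applyUpTo≡map f (suc n) = cong (f 0 ∷_) (trans (applyUpTo≡map (f ∘ suc) n) (sym (map-range-suc f 0 n)))

map-range-shift : ∀ {A : Set} (f : ℕ → A) a c n →
                  map f (range (a ℕ.+ c) n) ≡ map (λ x → f (x ℕ.+ c)) (range a n)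
map-range-shift f a c zero    = refl
map-range-shift f a c (suc n) = cong (f (a ℕ.+ c) ∷_) (map-range-shift f (suc a) c n)

reverse-range : ∀ {A : Set} (f : ℕ → A) n →
                reverse (map f (range 0 n)) ≡ map (λ i → f (n ℕ.∸ suc i)) (range 0 n)
reverse-range f zero    = refl
reverse-range f (suc n) = begin
  reverse (map f (range 0 (suc n)))      ≡⟨ cong (reverse ∘ map f) (range-snoc n) ⟩
  reverse (map f (range 0 n ++ [ n ]))   ≡⟨ cong reverse (map-++ f (range 0 n) [ n ]) ⟩
  reverse (map f (range 0 n) ++ [ f n ]) ≡⟨ reverse-++ (map f (range 0 n)) [ f n ] ⟩
  f n ∷ reverse (map f (range 0 n))      ≡⟨ cong (f n ∷_) (reverse-range f n) ⟩
  f n ∷ map (λ i → f (n ℕ.∸ suc i)) (range 0 n)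
    ≡⟨ cong (f n ∷_) (sym (map-range-suc (λ i → f (suc n ℕ.∸ suc i)) 0 n)) ⟩
  map (λ i → f (suc n ℕ.∸ suc i)) (range 0 (suc n)) ∎
  where
  open ≡-Reasoning
  range-snoc : ∀ n → range 0 (suc n) ≡ range 0 n ++ [ n ]
  range-snoc n = trans (cong (range 0) (ℕₚ.+-comm 1 n)) (range-++ 0 n 1)

map-range-cong : ∀ {A : Set} {R : A → A → Set} (f g : ℕ → A) c a n →
                 (∀ x → x ℕ.< a ℕ.+ n → R (f x) (g (x ℕ.+ c))) →
                 Pointwise R (map f (range a n)) (map g (range (a ℕ.+ c) n))
map-range-cong f g c a zero    hyp = []
map-range-cong f g c a (suc n) hyp =
  hyp a (ℕₚ.m<m+n a (s≤s z≤n)) ∷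
  map-range-cong f g c (suc a) n (λ x x< → hyp x (subst (x ℕ.<_) (sym (ℕₚ.+-suc a n)) x<))

without : ℕ → ℕ → List ℕ
without k m = range 0 k ++ range (suc k) m

length-without : ∀ k m → length (without k m) ≡ k ℕ.+ m
length-without k m rewrite length-++ (range 0 k) {range (suc k) m}
                         | length-range 0 k | length-range (suc k) m = refl

Π-without : ∀ (f : ℕ → ℤ) k m → Π (map f (range 0 (suc (k ℕ.+ m)))) ≡ Π (map f (without k m)) * f k
Π-without f k m = begin
  Π (map f (range 0 (suc (k ℕ.+ m))))              ≡⟨ cong (Π ∘ map f ∘ range 0) (sym (ℕₚ.+-suc k m)) ⟩
  Π (map f (range 0 (k ℕ.+ suc m)))                ≡⟨ cong (Π ∘ map f) (range-++ 0 k (suc m)) ⟩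
  Π (map f (range 0 k ++ range k (suc m)))         ≡⟨ cong Π (map-++ f (range 0 k) (range k (suc m))) ⟩
  Π (map f (range 0 k) ++ map f (range k (suc m))) ≡⟨ Π-++ (map f (range 0 k)) _ ⟩
  Π (map f (range 0 k)) * (f k * Π (map f (range (suc k) m)))
    ≡⟨ ring (Π (map f (range 0 k))) (f k) _ ⟩
  Π (map f (range 0 k)) * Π (map f (range (suc k) m)) * f k
    ≡⟨ cong (_* f k) (sym (Π-++ (map f (range 0 k)) _)) ⟩
  Π (map f (range 0 k) ++ map f (range (suc k) m)) * f k
    ≡⟨ cong (λ z → Π z * f k) (sym (map-++ f (range 0 k) _)) ⟩
  Π (map f (without k m)) * f k ∎
  where
  open ≡-Reasoning
  ring : ∀ a b c → a * (b * c) ≡ a * c * b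
  ring = solve-∀

Π-snoc : ∀ (f : ℕ → ℤ) n → Π (map f (range 0 (suc n))) ≡ Π (map f (range 0 n)) * f n
Π-snoc f n = begin
  Π (map f (range 0 (suc n)))           ≡⟨ cong (Π ∘ map f ∘ range 0 ∘ suc) (sym (ℕₚ.+-identityʳ n)) ⟩
  Π (map f (range 0 (suc (n ℕ.+ 0))))   ≡⟨ Π-without f n 0 ⟩
  Π (map f (range 0 n ++ [])) * f n     ≡⟨ cong (λ xs → Π (map f xs) * f n) (++-identityʳ (range 0 n)) ⟩
  Π (map f (range 0 n)) * f n           ∎
  where open ≡-Reasoning

Π-interleave : ∀ (g : ℕ → ℤ) n → Π (map g (range 0 (n ℕ.+ n))) ≡
               Π (map (λ j → g (j ℕ.+ j)) (range 0 n)) * Π (map (λ j → g (suc (j ℕ.+ j))) (range 0 n))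
Π-interleave g zero    = refl
Π-interleave g (suc n) = begin
  g 0 * Π (map g (range 1 (n ℕ.+ suc n)))
    ≡⟨ cong (λ z → g 0 * Π (map g (range 1 z))) (ℕₚ.+-suc n n) ⟩
  g 0 * (g 1 * Π (map g (range 2 (n ℕ.+ n))))
    ≡⟨ cong (λ z → g 0 * (g 1 * Π z)) (map-range-shift g 0 2 (n ℕ.+ n)) ⟩
  g 0 * (g 1 * Π (map g₂ (range 0 (n ℕ.+ n))))
    ≡⟨ cong (λ z → g 0 * (g 1 * z)) (Π-interleave g₂ n) ⟩
  g 0 * (g 1 * (Π (map (λ j → g₂ (j ℕ.+ j)) (range 0 n)) * Π (map (λ j → g₂ (suc (j ℕ.+ j))) (range 0 n))))
    ≡⟨ ring (g 0) (g 1) _ _ ⟩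
  g 0 * Π (map (λ j → g₂ (j ℕ.+ j)) (range 0 n)) * (g 1 * Π (map (λ j → g₂ (suc (j ℕ.+ j))) (range 0 n)))
    ≡⟨ cong₂ (λ u v → g 0 * Π u * (g 1 * Π v))
         (trans (map-cong (λ j → cong g (shift2 j)) (range 0 n)) (sym (map-range-suc (λ j → g (j ℕ.+ j)) 0 n)))
         (trans (map-cong (λ j → cong (g ∘ suc) (shift2 j)) (range 0 n))
                (sym (map-range-suc (λ j → g (suc (j ℕ.+ j))) 0 n))) ⟩
  g 0 * Π (map (λ j → g (j ℕ.+ j)) (range 1 n)) * (g 1 * Π (map (λ j → g (suc (j ℕ.+ j))) (range 1 n))) ∎
  where
  open ≡-Reasoning
  g₂ : ℕ → ℤ
  g₂ x = g (x ℕ.+ 2)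
  shift2 : ∀ j → j ℕ.+ j ℕ.+ 2 ≡ suc j ℕ.+ suc j
  shift2 j = trans (ℕₚ.+-comm (j ℕ.+ j) 2) (cong suc (sym (ℕₚ.+-suc j j)))
  ring : ∀ a b x y → a * (b * (x * y)) ≡ a * x * (b * y)
  ring = solve-∀

filter-range : ∀ k a m → filter (λ j → ¬? (j ≟ k ℕ.+ a)) (range a (k ℕ.+ suc m))
                         ≡ range a k ++ range (suc (k ℕ.+ a)) m
filter-range zero    a m =
  trans (filter-reject (λ j → ¬? (j ≟ a)) (λ a≢a → a≢a refl)) (keep-all m (suc a) (ℕₚ.n<1+n a))
  where
  keep-all : ∀ n b → a ℕ.< b → filter (λ j → ¬? (j ≟ a)) (range b n) ≡ range b n
  keep-all zero    b a<b = refl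
  keep-all (suc n) b a<b =
    trans (filter-accept (λ j → ¬? (j ≟ a)) (λ b≡a → ℕₚ.<-irrefl (sym b≡a) a<b))
          (cong (b ∷_) (keep-all n (suc b) (ℕₚ.m<n⇒m<1+n a<b)))
filter-range (suc k) a m =
  trans (filter-accept (λ j → ¬? (j ≟ suc k ℕ.+ a)) (λ a≡ → ℕₚ.<-irrefl a≡ (ℕₚ.m<n+m a (s≤s z≤n))))
        (cong (a ∷_) (subst (λ c → filter (λ j → ¬? (j ≟ c)) (range (suc a) (k ℕ.+ suc m))
                                    ≡ range (suc a) k ++ range (suc c) m)
                            (ℕₚ.+-suc k a) (filter-range k (suc a) m)))

range-bounded : ∀ a n → All (ℕ._< a ℕ.+ n) (range a n)
range-bounded a zero    = []
range-bounded a (suc n) =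
  ℕₚ.m<m+n a (s≤s z≤n) ∷ subst (λ b → All (ℕ._< b) (range (suc a) n)) (sym (ℕₚ.+-suc a n)) (range-bounded (suc a) n)
pos-affine : ∀ a b x → + (a ℕ.+ b ℕ.* x) ≡ + a + + b * + x
pos-affine a b x = trans (pos-+ a (b ℕ.* x)) (cong (λ z → + a + z) (pos-* b x))

double : ∀ n → n ℕ.+ n ≡ 2 ℕ.* n
double n = cong (n ℕ.+_) (sym (ℕₚ.+-identityʳ n))

quadruple : ∀ t → (t ℕ.+ t) ℕ.+ (t ℕ.+ t) ≡ t ℕ.* 4
quadruple = ℕ-Solver.solve-∀

neg-one-even : ∀ n → (- + 1) ^ (n ℕ.+ n) ≡ + 1
neg-one-even zero    = refl
neg-one-even (suc n) rewrite ℕₚ.+-suc n n | neg-one-even n = refl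

∂Π-negate : ∀ n xs → length xs ≡ n ℕ.+ n → ∂Π (map (- + 1 *_) xs) ≡ - ∂Π xs
∂Π-negate n xs len = begin
  ∂Π (map (- + 1 *_) xs)                      ≡⟨ ring (∂Π (map (- + 1 *_) xs)) ⟩
  - (∂Π (map (- + 1 *_) xs) * - + 1)          ≡⟨ cong -_ (∂Π-scale (- + 1) xs) ⟩
  - ((- + 1) ^ length xs * ∂Π xs)             ≡⟨ cong (λ k → - ((- + 1) ^ k * ∂Π xs)) len ⟩
  - ((- + 1) ^ (n ℕ.+ n) * ∂Π xs)             ≡⟨ cong (λ z → - (z * ∂Π xs)) (neg-one-even n) ⟩
  - (+ 1 * ∂Π xs)                             ≡⟨ cong -_ (*-identityˡ (∂Π xs)) ⟩
  - ∂Π xs                                     ∎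
  where
  open ≡-Reasoning
  ring : ∀ a → a ≡ - (a * - + 1)
  ring = solve-∀

odd-prime>2 : ∀ h → Prime (suc (h ℕ.+ h)) → 2 ℕ.< suc (h ℕ.+ h)
odd-prime>2 zero    isPrime = ⊥-elim (¬prime[1] isPrime)
odd-prime>2 (suc h) _       = s≤s (s≤s (subst (1 ℕ.≤_) (sym (ℕₚ.+-suc h h)) (s≤s z≤n)))

module OddPrime (h : ℕ) (isPrime : Prime (suc (h ℕ.+ h))) where

  n : ℕ
  n = h ℕ.+ h

  p : ℕ
  p = suc n

  P : ℤ
  P = + p

  P∤small : ∀ i → suc i ℕ.< p → ¬ P ∣ + suc i
  P∤small i i<p P∣i = ℕₚ.<⇒≱ i<p (ℕᵈ.∣⇒≤ (∣⇒∣ᵤ P∣i))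

  P∤2 : ¬ P ∣ + 2
  P∤2 = P∤small 1 (odd-prime>2 h isPrime)

  unit : ℕ → ℤ
  unit j = + suc j

  units : List ℤ
  units = map unit (range 0 n)

  U : ℤ
  U = Π units

  P∤U : ¬ P ∣ U
  P∤U = ∤Π isPrime (map⁺ (All.map (λ j<2h → P∤small _ (s≤s j<2h)) (range-bounded 0 n)))

  -- Σᵢ (p-1)!/i ≡ 0 (mod p): the map i ↦ p - i reverses the units and negates
  -- them modulo p, while ∂Π is invariant under reversal and, p - 1 being even,
  -- changes sign under negation; so 2 ∂Π(units) ≡ 0.
  ∂Π-units : P ∣ ∂Π units
  ∂Π-units = odd-part (euclid isPrime (+ 2) (∂Π units) (subst (P ∣_) difference≡double ∂Π-reflected))
    where
    odd-part : P ∣ + 2 ⊎ P ∣ ∂Π units → P ∣ ∂Π units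
    odd-part (inj₁ P∣2)  = ⊥-elim (P∤2 P∣2)
    odd-part (inj₂ P∣∂Π) = P∣∂Π
    reflect : ∀ x → x ℕ.< 0 ℕ.+ n → P ∣ unit (n ℕ.∸ suc x) - - + 1 * unit (x ℕ.+ 0)
    reflect x x<n = divides (+ 1) (begin
      unit (n ℕ.∸ suc x) - - + 1 * unit (x ℕ.+ 0)   ≡⟨ ring₁ (unit (n ℕ.∸ suc x)) (unit (x ℕ.+ 0)) ⟩
      + (suc (n ℕ.∸ suc x) ℕ.+ suc (x ℕ.+ 0))       ≡⟨ cong (λ y → + suc (n ℕ.∸ suc x ℕ.+ suc y)) (ℕₚ.+-identityʳ x) ⟩
      + suc (n ℕ.∸ suc x ℕ.+ suc x)                 ≡⟨ cong (+_ ∘ suc) (ℕₚ.m∸n+n≡m x<n) ⟩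
      P                                             ≡⟨ sym (*-identityˡ P) ⟩
      + 1 * P                                       ∎)
      where
      open ≡-Reasoning
      ring₁ : ∀ a b → a - - + 1 * b ≡ a + b
      ring₁ = solve-∀
    ∂Π-reflected : P ∣ ∂Π units - ∂Π (map (- + 1 *_) units)
    ∂Π-reflected = subst₂ (λ u v → P ∣ u - v)
      (trans (cong ∂Π (sym (reverse-range unit n))) (∂Π-reverse units))
      (cong ∂Π (map-∘ (range 0 n)))
      (∂Π-cong (map-range-cong _ _ 0 0 n reflect))
    difference≡double : ∂Π units - ∂Π (map (- + 1 *_) units) ≡ + 2 * ∂Π units
    difference≡double = trans (cong (λ z → ∂Π units - z) (∂Π-negate h units (trans (length-map unit (range 0 n)) (length-range 0 n))))
                              (ring₂ (∂Π units))
      where ring₂ : ∀ a → a - - a ≡ + 2 * a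
            ring₂ = solve-∀

  -- d(m+1), …, d(m+k), d·1, …, d·m: the multiples d·units in rotated order.
  rotated-multiples : ℤ → ℕ → ℕ → List ℤ
  rotated-multiples d k m = map (λ y → d * + y) (range (suc m) k) ++ map (λ y → d * + y) (range 1 m)

  ∂Π-rotated-multiples : ∀ d k m → k ℕ.+ m ≡ n → ∂Π (rotated-multiples d k m) ≡ ∂Π (map (d *_) units)
  ∂Π-rotated-multiples d k m k+m≡n = begin
    ∂Π (rotated-multiples d k m)                          ≡⟨ ∂Π-rotate (map scaled (range (suc m) k)) _ ⟩
    ∂Π (map scaled (range 1 m) ++ map scaled (range (1 ℕ.+ m) k))
      ≡⟨ cong ∂Π (sym (map-++ scaled (range 1 m) (range (1 ℕ.+ m) k))) ⟩
    ∂Π (map scaled (range 1 m ++ range (1 ℕ.+ m) k))      ≡⟨ cong (∂Π ∘ map scaled) (sym (range-++ 1 m k)) ⟩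
    ∂Π (map scaled (range 1 (m ℕ.+ k)))                   ≡⟨ cong (∂Π ∘ map scaled ∘ range 1) (trans (ℕₚ.+-comm m k) k+m≡n) ⟩
    ∂Π (map scaled (range 1 n))                           ≡⟨ cong ∂Π (map-range-suc scaled 0 n) ⟩
    ∂Π (map ((d *_) ∘ unit) (range 0 n))                  ≡⟨ cong ∂Π (map-∘ (range 0 n)) ⟩
    ∂Π (map (d *_) units)                                 ∎
    where
    open ≡-Reasoning
    scaled : ℕ → ℤ
    scaled y = d * + y

  -- ∂Π(d·units) = d^(p-2) ∂Π(units) ≡ 0 when p ∤ d.
  ∂Π-multiples : ∀ d → ¬ P ∣ d → P ∣ ∂Π (map (d *_) units)
  ∂Π-multiples d P∤d = drop-d (euclid isPrime (∂Π (map (d *_) units)) d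
                         (subst (P ∣_) (sym (∂Π-scale d units)) (∣n⇒∣m*n (d ^ length units) ∂Π-units)))
    where
    drop-d : P ∣ ∂Π (map (d *_) units) ⊎ P ∣ d → P ∣ ∂Π (map (d *_) units)
    drop-d (inj₁ P∣∂Π) = P∣∂Π
    drop-d (inj₂ P∣d)  = ⊥-elim (P∤d P∣d)

  -- Modulo p the terms 1 + d j (0 ≤ j ≤ 2h, j ≠ k) of a progression through
  -- p = 1 + d k are the rotated multiples: 1 + d j ≡ d(j + m + 1) for j < k,
  -- and 1 + d(k + y) = p + d y ≡ d y.
  progression≡rotated : ∀ d k m → k ℕ.+ m ≡ n → P ≡ + 1 + d * + k →
                        Congruentᴸ P (map (λ j → + 1 + d * + j) (without k m)) (rotated-multiples d k m)
  progression≡rotated d k m k+m≡n P≡1+dk =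
    subst (λ xs → Congruentᴸ P xs (rotated-multiples d k m)) (sym (map-++ term (range 0 k) (range (suc k) m)))
      (++⁺ (map-range-cong term scaled (suc m) 0 k before)
           (Congruentᴸ-sym (map-range-cong scaled term k 1 m after)))
    where
    term scaled : ℕ → ℤ
    term j   = + 1 + d * + j
    scaled y = d * + y
    m≡dk-k : + m ≡ d * + k - + k
    m≡dk-k = begin
      + m                           ≡⟨ ring₁ (+ k) (+ m) ⟩
      + 1 + (+ k + + m) - + 1 - + k ≡⟨ cong (λ z → z - + 1 - + k) (trans (cong (+_ ∘ suc) k+m≡n) P≡1+dk) ⟩
      + 1 + d * + k - + 1 - + k     ≡⟨ ring₂ d (+ k) ⟩
      d * + k - + k                 ∎
      where
      open ≡-Reasoning
      ring₁ : ∀ k m → m ≡ + 1 + (k + m) - + 1 - k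
      ring₁ = solve-∀
      ring₂ : ∀ d k → + 1 + d * k - + 1 - k ≡ d * k - k
      ring₂ = solve-∀
    before : ∀ x → x ℕ.< 0 ℕ.+ k → P ∣ term x - scaled (x ℕ.+ suc m)
    before x _ = divides (+ 1 - d) (begin
      + 1 + d * + x - d * (+ x + (+ 1 + + m))               ≡⟨ cong (λ z → + 1 + d * + x - d * (+ x + (+ 1 + z))) m≡dk-k ⟩
      + 1 + d * + x - d * (+ x + (+ 1 + (d * + k - + k)))   ≡⟨ ring d (+ k) (+ x) ⟩
      (+ 1 - d) * (+ 1 + d * + k)                           ≡⟨ cong ((+ 1 - d) *_) (sym P≡1+dk) ⟩
      (+ 1 - d) * P                                         ∎)
      where
      open ≡-Reasoning
      ring : ∀ d k x → + 1 + d * x - d * (x + (+ 1 + (d * k - k))) ≡ (+ 1 - d) * (+ 1 + d * k)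
      ring = solve-∀
    after : ∀ x → x ℕ.< 1 ℕ.+ m → P ∣ scaled x - term (x ℕ.+ k)
    after x _ = divides (- + 1) (begin
      d * + x - (+ 1 + d * (+ x + + k))   ≡⟨ ring d (+ k) (+ x) ⟩
      - + 1 * (+ 1 + d * + k)             ≡⟨ cong ((- + 1) *_) (sym P≡1+dk) ⟩
      - + 1 * P                           ∎)
      where
      open ≡-Reasoning
      ring : ∀ d k x → d * x - (+ 1 + d * (x + k)) ≡ - + 1 * (+ 1 + d * k)
      ring = solve-∀

  ∂Π-progression : ∀ d k m → k ℕ.+ m ≡ n → P ≡ + 1 + d * + k → ¬ P ∣ d →
                   P ∣ ∂Π (map (λ j → + 1 + d * + j) (without k m))
  ∂Π-progression d k m k+m≡n P≡1+dk P∤d =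
    subst (P ∣_) (ring (∂Π terms) (∂Π (rotated-multiples d k m)))
      (∣m∣n⇒∣m+n (∂Π-cong (progression≡rotated d k m k+m≡n P≡1+dk))
                 (subst (P ∣_) (sym (∂Π-rotated-multiples d k m k+m≡n)) (∂Π-multiples d P∤d)))
    where
    terms : List ℤ
    terms = map (λ j → + 1 + d * + j) (without k m)
    ring : ∀ a b → (a - b) + b ≡ a
    ring = solve-∀

  odd : ℕ → ℤ
  odd j = + 1 + + 2 * + j

  odds : List ℤ
  odds = map odd (without h h)

  O : ℤ
  O = Π odds

  -- p = odd h is the omitted odd number; the others form a progression through p.
  odd-h : P ≡ odd h
  odd-h = trans (cong (+_ ∘ suc) (double h)) (pos-affine 1 2 h)

  ∂Π-odds : P ∣ ∂Π odds
  ∂Π-odds = ∂Π-progression (+ 2) h h refl odd-h P∤2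

  Q : ℤ
  Q = Π (map (_+ P) units)

  Q≡U : P * P ∣ Q - U
  Q≡U = subst (λ c → P * P ∣ Π (map (_+ c) units) - U) (*-identityˡ P) (Π-shift-mod² P (+ 1) units ∂Π-units)

  W : ℤ
  W = Π (map unit (range 0 (p ℕ.+ p)))

  W-by-parity : W ≡ O * P * (+ 2 * (+ 2) ^ n * (U * P))
  W-by-parity = begin
    W ≡⟨ Π-interleave unit p ⟩
    Π (map (λ j → unit (j ℕ.+ j)) (range 0 p)) * Π (map (λ j → unit (suc (j ℕ.+ j))) (range 0 p))
      ≡⟨ cong₂ (λ u v → Π u * Π v) (map-cong even (range 0 p)) (map-cong odd-index (range 0 p)) ⟩
    Π (map odd (range 0 p)) * Π (map (λ j → + 2 * unit j) (range 0 p))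
      ≡⟨ cong₂ _*_ (Π-without odd h h)
                   (trans (cong Π (map-∘ {g = (+ 2) *_} {f = unit} (range 0 p))) (Π-scale (+ 2) (map unit (range 0 p)))) ⟩
    O * odd h * ((+ 2) ^ length (map unit (range 0 p)) * Π (map unit (range 0 p)))
      ≡⟨ cong₂ (λ u v → O * u * ((+ 2) ^ v * Π (map unit (range 0 p)))) (sym odd-h)
               (trans (length-map unit (range 0 p)) (length-range 0 p)) ⟩
    O * P * (+ 2 * (+ 2) ^ n * Π (map unit (range 0 p)))  ≡⟨ cong (λ z → O * P * (+ 2 * (+ 2) ^ n * z)) (Π-snoc unit n) ⟩
    O * P * (+ 2 * (+ 2) ^ n * (U * P))                     ∎
    where
    open ≡-Reasoning
    even : ∀ j → unit (j ℕ.+ j) ≡ odd j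
    even j = trans (cong (+_ ∘ suc) (double j)) (pos-affine 1 2 j)
    odd-index : ∀ j → unit (suc (j ℕ.+ j)) ≡ + 2 * unit j
    odd-index j = trans (cong +_ (trans (cong suc (sym (ℕₚ.+-suc j j))) (double (suc j)))) (pos-* 2 (suc j))

  W-by-halves : W ≡ U * P * (Q * (+ 2 * P))
  W-by-halves = begin
    W                                                   ≡⟨ cong (Π ∘ map unit) (range-++ 0 p p) ⟩
    Π (map unit (range 0 p ++ range p p))               ≡⟨ cong Π (map-++ unit (range 0 p) (range p p)) ⟩
    Π (map unit (range 0 p) ++ map unit (range p p))    ≡⟨ Π-++ (map unit (range 0 p)) _ ⟩
    Π (map unit (range 0 p)) * Π (map unit (range (0 ℕ.+ p) p))
      ≡⟨ cong₂ (λ u v → u * Π v) (Π-snoc unit n) (map-range-shift unit 0 p p) ⟩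
    U * P * Π (map (unit ∘ (ℕ._+ p)) (range 0 p))       ≡⟨ cong (U * P *_) (Π-snoc (unit ∘ (ℕ._+ p)) n) ⟩
    U * P * (Π (map ((_+ P) ∘ unit) (range 0 n)) * unit (n ℕ.+ p))
      ≡⟨ cong₂ (λ u v → U * P * (Π u * v)) (map-∘ (range 0 n)) (trans (cong +_ (double p)) (pos-* 2 p)) ⟩
    U * P * (Q * (+ 2 * P))                              ∎
    where open ≡-Reasoning

  -- 2^(p-1) O ≡ (p-1)! (mod p²): comparing the two factorisations of W gives
  -- O 2^(p-1) U = U Q, and Q ≡ U while p ∤ U.
  odds-mod² : P * P ∣ (+ 2) ^ n * O - U
  odds-mod² = cancel-mod² isPrime (e * O - U) U P∤U (subst (P * P ∣_) factor (∣n⇒∣m*n U Q≡U))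
    where
    e : ℤ
    e = (+ 2) ^ n
    OeU≡UQ : O * e * U ≡ U * Q
    OeU≡UQ = *-cancelʳ-≡ _ _ (+ 2 * P * P)
               (trans (ring₁ O e U P) (trans (sym W-by-parity) (trans W-by-halves (ring₂ U Q P))))
      where
      ring₁ : ∀ O e U P → O * e * U * (+ 2 * P * P) ≡ O * P * (+ 2 * e * (U * P))
      ring₁ = solve-∀
      ring₂ : ∀ U Q P → U * P * (Q * (+ 2 * P)) ≡ U * Q * (+ 2 * P * P)
      ring₂ = solve-∀
    factor : U * (Q - U) ≡ (e * O - U) * U
    factor = trans (ring₁ U Q) (trans (cong (_- U * U) (sym OeU≡UQ)) (ring₂ O e U))
      where
      ring₁ : ∀ U Q → U * (Q - U) ≡ U * Q - U * U
      ring₁ = solve-∀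
      ring₂ : ∀ O e U → O * e * U - U * U ≡ (e * O - U) * U
      ring₂ = solve-∀

module OneModFour (t : ℕ) (isPrime : Prime (suc ((t ℕ.+ t) ℕ.+ (t ℕ.+ t)))) where
  open OddPrime (t ℕ.+ t) isPrime

  m : ℕ
  m = t ℕ.+ (t ℕ.+ t)

  t+m≡n : t ℕ.+ m ≡ n
  t+m≡n = sym (ℕₚ.+-assoc t t (t ℕ.+ t))

  m+t≡n : m ℕ.+ t ≡ n
  m+t≡n = trans (ℕₚ.+-comm m t) t+m≡n

  Π-range-p : ∀ (f : ℕ → ℤ) k l → k ℕ.+ l ≡ n → Π (map f (range 0 p)) ≡ Π (map f (without k l)) * f k
  Π-range-p f k l k+l≡n = trans (cong (λ z → Π (map f (range 0 (suc z)))) (sym k+l≡n)) (Π-without f k l)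

  a₄ c₄ : ℕ → ℤ
  a₄ j = + 1 + + 4 * + j
  c₄ j = + 3 + + 4 * + j

  -- A = ∏_{j ∈ [0,p), j ≠ t} (1 + 4j), the square root of the numerator of F(0);
  -- C is the analogous product of the terms 3 + 4j other than 3p, and O′ the
  -- product of the odd numbers in (2p, 4p) other than 3p.
  A-terms : List ℤ
  A-terms = map a₄ (without t m)

  A C O′ : ℤ
  A  = Π A-terms
  C  = Π (map c₄ (without m t))
  O′ = Π (map (_+ + 2 * P) odds)

  P≡a₄t : P ≡ a₄ t
  P≡a₄t = cong (λ z → + 1 + z) (ring (+ t))
    where ring : ∀ t → t + t + (t + t) ≡ + 4 * t
          ring = solve-∀

  c₄m≡3P : c₄ m ≡ + 3 * P
  c₄m≡3P = ring (+ t)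
    where ring : ∀ t → + 3 + + 4 * (t + (t + t)) ≡ + 3 * (+ 1 + (t + t + (t + t)))
          ring = solve-∀

  odd+p : ∀ x → odd (x ℕ.+ p) ≡ odd x + + 2 * P
  odd+p x = ring (+ x) P
    where ring : ∀ x P → + 1 + + 2 * (x + P) ≡ + 1 + + 2 * x + + 2 * P
          ring = solve-∀

  V : ℤ
  V = Π (map odd (range 0 (p ℕ.+ p)))

  V-by-residue : V ≡ A * P * (C * (+ 3 * P))
  V-by-residue = begin
    V ≡⟨ Π-interleave odd p ⟩
    Π (map (λ j → odd (j ℕ.+ j)) (range 0 p)) * Π (map (λ j → odd (suc (j ℕ.+ j))) (range 0 p))
      ≡⟨ cong₂ (λ u v → Π u * Π v) (map-cong (λ j → even (+ j)) (range 0 p)) (map-cong (λ j → odd-index (+ j)) (range 0 p)) ⟩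
    Π (map a₄ (range 0 p)) * Π (map c₄ (range 0 p))  ≡⟨ cong₂ _*_ (Π-range-p a₄ t m t+m≡n) (Π-range-p c₄ m t m+t≡n) ⟩
    A * a₄ t * (C * c₄ m)                             ≡⟨ cong₂ (λ u v → A * u * (C * v)) (sym P≡a₄t) c₄m≡3P ⟩
    A * P * (C * (+ 3 * P))                           ∎
    where
    open ≡-Reasoning
    even : ∀ j → + 1 + + 2 * (j + j) ≡ + 1 + + 4 * j
    even = solve-∀
    odd-index : ∀ j → + 1 + + 2 * (+ 1 + (j + j)) ≡ + 3 + + 4 * j
    odd-index = solve-∀

  V-by-halves : V ≡ O * P * (O′ * (+ 3 * P))
  V-by-halves = begin
    V                                                  ≡⟨ cong (Π ∘ map odd) (range-++ 0 p p) ⟩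
    Π (map odd (range 0 p ++ range p p))               ≡⟨ cong Π (map-++ odd (range 0 p) (range p p)) ⟩
    Π (map odd (range 0 p) ++ map odd (range p p))     ≡⟨ Π-++ (map odd (range 0 p)) _ ⟩
    Π (map odd (range 0 p)) * Π (map odd (range (0 ℕ.+ p) p))
      ≡⟨ cong₂ (λ u v → u * Π v) (Π-without odd (t ℕ.+ t) (t ℕ.+ t)) (map-range-shift odd 0 p p) ⟩
    O * odd (t ℕ.+ t) * Π (map (odd ∘ (ℕ._+ p)) (range 0 p))
      ≡⟨ cong₂ (λ u v → O * u * v) (sym odd-h) (Π-without (odd ∘ (ℕ._+ p)) (t ℕ.+ t) (t ℕ.+ t)) ⟩
    O * P * (Π (map (odd ∘ (ℕ._+ p)) (without (t ℕ.+ t) (t ℕ.+ t))) * odd (t ℕ.+ t ℕ.+ p))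
      ≡⟨ cong₂ (λ u v → O * P * (Π u * v))
           (trans (map-cong odd+p (without (t ℕ.+ t) (t ℕ.+ t))) (map-∘ (without (t ℕ.+ t) (t ℕ.+ t))))
           (trans (odd+p (t ℕ.+ t)) (cong (_+ + 2 * P) (sym odd-h))) ⟩
    O * P * (O′ * (P + + 2 * P))                       ≡⟨ cong (λ z → O * P * (O′ * z)) (ring₃ P) ⟩
    O * P * (O′ * (+ 3 * P))                           ∎
    where
    open ≡-Reasoning
    ring₃ : ∀ P → P + + 2 * P ≡ + 3 * P
    ring₃ = solve-∀

  AC≡OO′ : A * C ≡ O * O′
  AC≡OO′ = *-cancelʳ-≡ _ _ (P * (+ 3 * P)) (trans (sym (ring A C P)) (trans (sym V-by-residue) (trans V-by-halves (ring O O′ P))))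
    where
    ring : ∀ A C P → A * P * (C * (+ 3 * P)) ≡ A * C * (P * (+ 3 * P))
    ring = solve-∀

  P∤4 : ¬ P ∣ + 4
  P∤4 P∣4 = P∤2 (twice (euclid isPrime (+ 2) (+ 2) P∣4))
    where
    twice : P ∣ + 2 ⊎ P ∣ + 2 → P ∣ + 2
    twice (inj₁ P∣2) = P∣2
    twice (inj₂ P∣2) = P∣2

  -- Read backwards, 3 + 4(p-1-i) = -((1 + 4i) - 4p): the terms of C are, up to
  -- sign, the terms of A shifted by -4p.
  reflect : ℕ → ℤ
  reflect i = - + 1 * (a₄ i + - + 4 * P)

  c₄-backwards : ∀ i → i ℕ.< 0 ℕ.+ p → c₄ (p ℕ.∸ suc i) ≡ reflect (i ℕ.+ 0)
  c₄-backwards i i<p = begin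
    + 3 + + 4 * + (n ℕ.∸ i)                                        ≡⟨ ring (+ (n ℕ.∸ i)) (+ i) ⟩
    - + 1 * (+ 1 + + 4 * + i + - + 4 * (+ 1 + (+ (n ℕ.∸ i) + + i)))
      ≡⟨ cong₂ (λ j z → - + 1 * (+ 1 + + 4 * + j + - + 4 * z)) (sym (ℕₚ.+-identityʳ i))
               (cong (+_ ∘ suc) (ℕₚ.m∸n+n≡m (ℕₚ.≤-pred i<p))) ⟩
    reflect (i ℕ.+ 0)                                              ∎
    where
    open ≡-Reasoning
    ring : ∀ D I → + 3 + + 4 * D ≡ - + 1 * (+ 1 + + 4 * I + - + 4 * (+ 1 + (D + I)))
    ring = solve-∀

  C≡reflected-A : C ≡ Π (map reflect (without t m))
  C≡reflected-A = *-cancelʳ-≡ C _ (+ 3 * P) (begin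
    C * (+ 3 * P)                              ≡⟨ cong (C *_) (sym c₄m≡3P) ⟩
    C * c₄ m                                   ≡⟨ sym (Π-range-p c₄ m t m+t≡n) ⟩
    Π (map c₄ (range 0 p))                     ≡⟨ sym (Π-reverse (map c₄ (range 0 p))) ⟩
    Π (reverse (map c₄ (range 0 p)))           ≡⟨ cong Π (reverse-range c₄ p) ⟩
    Π (map (λ i → c₄ (p ℕ.∸ suc i)) (range 0 p))
      ≡⟨ cong Π (Pointwise-≡⇒≡ (map-range-cong _ reflect 0 0 p c₄-backwards)) ⟩
    Π (map reflect (range 0 p))                ≡⟨ Π-range-p reflect t m t+m≡n ⟩
    Π (map reflect (without t m)) * reflect t  ≡⟨ cong (Π (map reflect (without t m)) *_) reflect-t ⟩
    Π (map reflect (without t m)) * (+ 3 * P)  ∎)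
    where
    open ≡-Reasoning
    reflect-t : reflect t ≡ + 3 * P
    reflect-t = trans (cong (λ z → - + 1 * (z + - + 4 * P)) (sym P≡a₄t)) (ring P)
      where ring : ∀ P → - + 1 * (P + - + 4 * P) ≡ + 3 * P
            ring = solve-∀

  -- the p - 1 sign changes cancel
  C≡shifted-A : C ≡ Π (map (_+ - + 4 * P) A-terms)
  C≡shifted-A = begin
    C                                          ≡⟨ C≡reflected-A ⟩
    Π (map reflect (without t m))              ≡⟨ cong Π (trans (map-∘ (without t m)) (cong (map (- + 1 *_)) (map-∘ (without t m)))) ⟩
    Π (map (- + 1 *_) shifted)                 ≡⟨ Π-scale (- + 1) shifted ⟩
    (- + 1) ^ length shifted * Π shifted       ≡⟨ cong (λ k → (- + 1) ^ k * Π shifted) length-shifted ⟩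
    (- + 1) ^ n * Π shifted                    ≡⟨ cong (_* Π shifted) (neg-one-even (t ℕ.+ t)) ⟩
    + 1 * Π shifted                            ≡⟨ *-identityˡ (Π shifted) ⟩
    Π shifted                                  ∎
    where
    open ≡-Reasoning
    shifted : List ℤ
    shifted = map (_+ - + 4 * P) A-terms
    length-shifted : length shifted ≡ n
    length-shifted = trans (length-map _ A-terms)
                       (trans (length-map a₄ (without t m)) (trans (length-without t m) t+m≡n))

  -- C ≡ A (mod p²): the shift by -4p is invisible modulo p² as p ∣ ∂Π(A-terms).
  C≡A : P * P ∣ C - A
  C≡A = subst (λ z → P * P ∣ z - A) (sym C≡shifted-A)
          (Π-shift-mod² P (- + 4) A-terms (∂Π-progression (+ 4) t m t+m≡n P≡a₄t P∤4))

  twoPow-A-mod² : P * P ∣ (+ 2) ^ n * A * ((+ 2) ^ n * A) - U * U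
  twoPow-A-mod² = square-congruence A C O O′ ((+ 2) ^ n) U AC≡OO′ C≡A
                    (Π-shift-mod² P (+ 2) odds ∂Π-odds) odds-mod²

prodᵘ : List ℚᵘ → ℚᵘ
prodᵘ = foldr ℚᵘ._*_ 1ℚᵘ

toℚᵘ-prodℚ : ∀ {A : Set} (f : A → ℚ) (g : A → ℚᵘ) → (∀ x → toℚᵘ (f x) ≃ g x) →
             ∀ xs → toℚᵘ (prodℚ (map f xs)) ≃ prodᵘ (map g xs)
toℚᵘ-prodℚ f g f≃g []       = ℚᵘₚ.≃-refl
toℚᵘ-prodℚ f g f≃g (x ∷ xs) =
  ℚᵘₚ.≃-trans (ℚₚ.toℚᵘ-homo-* (f x) (prodℚ (map f xs))) (ℚᵘₚ.*-cong (f≃g x) (toℚᵘ-prodℚ f g f≃g xs))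

↥-* : ∀ x y → ↥ᵘ (x ℚᵘ.* y) ≡ ↥ᵘ x * ↥ᵘ y
↥-* (mkℚᵘ _ _) (mkℚᵘ _ _) = refl

↧-* : ∀ x y → ↧ᵘ (x ℚᵘ.* y) ≡ ↧ᵘ x * ↧ᵘ y
↧-* (mkℚᵘ _ b) (mkℚᵘ _ d) = pos-* (suc b) (suc d)

↥-prodᵘ : ∀ ys → ↥ᵘ (prodᵘ ys) ≡ Π (map ↥ᵘ_ ys)
↥-prodᵘ []       = refl
↥-prodᵘ (y ∷ ys) = trans (↥-* y (prodᵘ ys)) (cong (↥ᵘ y *_) (↥-prodᵘ ys))

↧-prodᵘ : ∀ ys → ↧ᵘ (prodᵘ ys) ≡ Π (map ↧ᵘ_ ys)
↧-prodᵘ []       = refl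
↧-prodᵘ (y ∷ ys) = trans (↧-* y (prodᵘ ys)) (cong (↧ᵘ y *_) (↧-prodᵘ ys))

toℚᵘ-sq : ∀ i k → toℚᵘ (sq (i ℚ./ suc k)) ≃ mkℚᵘ i k ℚᵘ.* mkℚᵘ i k
toℚᵘ-sq i k = ℚᵘₚ.≃-trans (ℚₚ.toℚᵘ-homo-* (i ℚ./ suc k) (i ℚ./ suc k))
                          (ℚᵘₚ.*-cong (ℚₚ.toℚᵘ-fromℚᵘ (mkℚᵘ i k)) (ℚₚ.toℚᵘ-fromℚᵘ (mkℚᵘ i k)))

≡1-mod-p² : ∀ {p} → Prime p → ∀ x y → toℚᵘ x ≃ y → ¬ + p ∣ ↧ᵘ y →
            + p * + p ∣ ↥ᵘ y - ↧ᵘ y → x ≡ 1ℚ [mod p ^ 2 ]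
≡1-mod-p² {p} isPrime x (mkℚᵘ a b) x≃a/b P∤b P²∣a-b =
  ∣⇒∣ᵤ (subst (_∣ ↥ r) (sym p²) (cancel-mod² isPrime (↥ r) (+ suc b) P∤b P²∣↥r·b))
  where
  r : ℚ
  r = x ℚ.- 1ℚ
  y-1 : ℚᵘ
  y-1 = mkℚᵘ a b ℚᵘ.+ ℚᵘ.- 1ℚᵘ
  r≃ : toℚᵘ r ≃ y-1
  r≃ = ℚᵘₚ.≃-trans (ℚₚ.toℚᵘ-homo-+ x (ℚ.- 1ℚ)) (ℚᵘₚ.+-cong x≃a/b (ℚₚ.toℚᵘ-homo‿- 1ℚ))
  cross-multiply : ∀ {u v} → u ≃ v → ↥ᵘ u * ↧ᵘ v ≡ ↥ᵘ v * ↧ᵘ u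
  cross-multiply (*≡* eq) = eq
  cross : ↥ r * + suc b ≡ (a - + suc b) * ↧ r
  cross = begin
    ↥ r * + suc b                          ≡⟨ cong₂ _*_ (sym (ℚₚ.↥ᵘ-toℚᵘ r)) (sym (trans (pos-* (suc b) 1) (*-identityʳ (+ suc b)))) ⟩
    ↥ᵘ toℚᵘ r * ↧ᵘ y-1                     ≡⟨ cross-multiply r≃ ⟩
    ↥ᵘ y-1 * ↧ᵘ toℚᵘ r                     ≡⟨ cong₂ _*_ (ring a (+ suc b)) (ℚₚ.↧ᵘ-toℚᵘ r) ⟩
    (a - + suc b) * ↧ r                    ∎
    where
    open ≡-Reasoning
    ring : ∀ a b → a * + 1 + - + 1 * b ≡ a - b
    ring = solve-∀
  P²∣↥r·b : + p * + p ∣ ↥ r * + suc b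
  P²∣↥r·b = subst (+ p * + p ∣_) (sym cross) (∣m⇒∣m*n (↧ r) P²∣a-b)
  p² : + (p ℕ.^ 2) ≡ + p * + p
  p² = trans (cong (λ z → + (p ℕ.* z)) (ℕₚ.*-identityʳ p)) (pos-* p p)

module FAtZero (t : ℕ) (isPrime : Prime (suc ((t ℕ.+ t) ℕ.+ (t ℕ.+ t)))) where
  open OddPrime (t ℕ.+ t) isPrime
  open OneModFour t isPrime

  indices : filter (λ j → ¬? (j ≟ (p ℕ.∸ 1) / 4)) (upTo p) ≡ without t m
  indices = begin
    filter (λ j → ¬? (j ≟ n / 4)) (upTo p)
      ≡⟨ cong₂ (λ c xs → filter (λ j → ¬? (j ≟ c)) xs) n/4≡t (trans (upTo≡range p) (cong (range 0) p≡t+1+m)) ⟩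
    filter (λ j → ¬? (j ≟ t ℕ.+ 0)) (range 0 (t ℕ.+ suc m))  ≡⟨ filter-range t 0 m ⟩
    range 0 t ++ range (suc (t ℕ.+ 0)) m                     ≡⟨ cong (λ z → range 0 t ++ range (suc z) m) (ℕₚ.+-identityʳ t) ⟩
    without t m                                              ∎
    where
    open ≡-Reasoning
    n/4≡t : n / 4 ≡ t ℕ.+ 0
    n/4≡t = trans (cong (_/ 4) (quadruple t)) (trans (m*n/n≡m t 4) (sym (ℕₚ.+-identityʳ t)))
    p≡t+1+m : p ≡ t ℕ.+ suc m
    p≡t+1+m = sym (trans (ℕₚ.+-suc t m) (cong suc t+m≡n))

  root : ℕ → ℕ
  root j = 1 ℕ.+ 4 ℕ.* j ℕ.+ 4 ℕ.* 0 ℕ.* p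

  numerator-factor denominator-factor : ℕ → ℚᵘ
  numerator-factor j   = mkℚᵘ (+ root j) 0 ℚᵘ.* mkℚᵘ (+ root j) 0
  denominator-factor i = mkℚᵘ (+ 1) (i ℕ.+ 0 ℕ.* p) ℚᵘ.* mkℚᵘ (+ 1) (i ℕ.+ 0 ℕ.* p)

  X NA NB Y : ℚᵘ
  X  = mkℚᵘ (+ (4 ℕ.^ n)) 0
  NA = prodᵘ (map numerator-factor (without t m))
  NB = prodᵘ (map denominator-factor (upTo n))
  Y  = X ℚᵘ.* NA ℚᵘ.* NB

  F≃Y : toℚᵘ (F p 0) ≃ Y
  F≃Y = subst (λ js → toℚᵘ (F p 0) ≃ X ℚᵘ.* prodᵘ (map numerator-factor js) ℚᵘ.* NB) indices
          (ℚᵘₚ.≃-trans (ℚₚ.toℚᵘ-homo-* (ℕ→ℚ (4 ℕ.^ n) ℚ.* prodℚ (map F-numerator Lf)) (prodℚ (map F-denominator (upTo n))))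
            (ℚᵘₚ.*-cong (ℚᵘₚ.≃-trans (ℚₚ.toℚᵘ-homo-* (ℕ→ℚ (4 ℕ.^ n)) (prodℚ (map F-numerator Lf)))
                          (ℚᵘₚ.*-cong (ℚₚ.toℚᵘ-fromℚᵘ X)
                                      (toℚᵘ-prodℚ F-numerator numerator-factor (λ j → toℚᵘ-sq (+ root j) 0) Lf)))
                        (toℚᵘ-prodℚ F-denominator denominator-factor (λ i → toℚᵘ-sq (+ 1) (i ℕ.+ 0 ℕ.* p)) (upTo n))))
    where
    Lf : List ℕ
    Lf = filter (λ j → ¬? (j ≟ (p ℕ.∸ 1) / 4)) (upTo p)
    F-numerator F-denominator : ℕ → ℚ
    F-numerator j   = sq (ℕ→ℚ (root j))
    F-denominator i = sq ((+ 1) ℚ./ suc (i ℕ.+ 0 ℕ.* p))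

  e : ℤ
  e = (+ 2) ^ n

  ↥Y : ↥ᵘ Y ≡ e * A * (e * A)
  ↥Y = begin
    ↥ᵘ Y                                                  ≡⟨ ↥-* (X ℚᵘ.* NA) NB ⟩
    ↥ᵘ (X ℚᵘ.* NA) * ↥ᵘ NB                                 ≡⟨ cong₂ _*_ (↥-* X NA) (↥-prodᵘ (map denominator-factor (upTo n))) ⟩
    + (4 ℕ.^ n) * ↥ᵘ NA * Π (map ↥ᵘ_ (map denominator-factor (upTo n)))
      ≡⟨ cong₂ (λ u v → u * ↥ᵘ NA * v) (pos-4^ n)
               (trans (cong Π (sym (map-∘ {g = ↥ᵘ_} {f = denominator-factor} (upTo n)))) (Π-ones (upTo n))) ⟩
    e * e * ↥ᵘ NA * + 1                                    ≡⟨ cong (λ z → e * e * z * + 1) (↥-prodᵘ (map numerator-factor (without t m))) ⟩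
    e * e * Π (map ↥ᵘ_ (map numerator-factor (without t m))) * + 1
      ≡⟨ cong (λ z → e * e * Π z * + 1)
              (trans (sym (map-∘ {g = ↥ᵘ_} {f = numerator-factor} (without t m)))
                     (trans (map-cong square-a₄ (without t m)) (map-∘ {g = λ x → x * x} {f = a₄} (without t m)))) ⟩
    e * e * Π (map (λ x → x * x) A-terms) * + 1            ≡⟨ cong (λ z → e * e * z * + 1) (Π-square A-terms) ⟩
    e * e * (A * A) * + 1                                  ≡⟨ ring e A ⟩
    e * A * (e * A)                                        ∎
    where
    open ≡-Reasoning
    pos-4^ : ∀ k → + (4 ℕ.^ k) ≡ (+ 2) ^ k * (+ 2) ^ k
    pos-4^ zero    = refl
    pos-4^ (suc k) = trans (pos-* 4 (4 ℕ.^ k)) (trans (cong (+ 4 *_) (pos-4^ k)) (ring₄ ((+ 2) ^ k)))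
      where ring₄ : ∀ a → + 4 * (a * a) ≡ + 2 * a * (+ 2 * a)
            ring₄ = solve-∀
    square-a₄ : ∀ j → ↥ᵘ numerator-factor j ≡ a₄ j * a₄ j
    square-a₄ j = cong (λ z → z * z) (trans (cong +_ (ℕₚ.+-identityʳ (1 ℕ.+ 4 ℕ.* j))) (pos-affine 1 4 j))
    ring : ∀ e A → e * e * (A * A) * + 1 ≡ e * A * (e * A)
    ring = solve-∀

  ↧Y : ↧ᵘ Y ≡ U * U
  ↧Y = begin
    ↧ᵘ Y                                                  ≡⟨ ↧-* (X ℚᵘ.* NA) NB ⟩
    ↧ᵘ (X ℚᵘ.* NA) * ↧ᵘ NB                                 ≡⟨ cong₂ _*_ (↧-* X NA) (↧-prodᵘ (map denominator-factor (upTo n))) ⟩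
    + 1 * ↧ᵘ NA * Π (map ↧ᵘ_ (map denominator-factor (upTo n)))
      ≡⟨ cong₂ (λ u v → + 1 * u * Π v)
           (trans (↧-prodᵘ (map numerator-factor (without t m)))
                  (trans (cong Π (sym (map-∘ {g = ↧ᵘ_} {f = numerator-factor} (without t m)))) (Π-ones (without t m))))
           (trans (sym (map-∘ {g = ↧ᵘ_} {f = denominator-factor} (upTo n)))
             (trans (map-cong square-unit (upTo n))
               (trans (cong (map (λ j → unit j * unit j)) (upTo≡range n)) (map-∘ {g = λ x → x * x} {f = unit} (range 0 n))))) ⟩
    + 1 * + 1 * Π (map (λ x → x * x) units)                ≡⟨ trans (*-identityˡ _) (Π-square units) ⟩
    U * U                                                  ∎
    where
    open ≡-Reasoning
    square-unit : ∀ i → ↧ᵘ denominator-factor i ≡ unit i * unit i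
    square-unit i = trans (↧-* (mkℚᵘ (+ 1) (i ℕ.+ 0)) (mkℚᵘ (+ 1) (i ℕ.+ 0)))
                          (cong (λ z → + suc z * + suc z) (ℕₚ.+-identityʳ i))

  F[0]≡1 : F p 0 ≡ 1ℚ [mod p ^ 2 ]
  F[0]≡1 = ≡1-mod-p² isPrime (F p 0) Y F≃Y P∤↧Y
             (subst₂ (λ a b → P * P ∣ a - b) (sym ↥Y) (sym ↧Y) twoPow-A-mod²)
    where
    P∤↧Y : ¬ P ∣ ↧ᵘ Y
    P∤↧Y P∣Y = P∤U (one-factor (euclid isPrime U U (subst (P ∣_) ↧Y P∣Y)))
      where
      one-factor : P ∣ U ⊎ P ∣ U → P ∣ U
      one-factor (inj₁ P∣U) = P∣U
      one-factor (inj₂ P∣U) = P∣U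

corollary3p2 : (p : ℕ) → Prime p → p % 4 ≡ 1 → F p 0 ≡ 1ℚ [mod p ^ 2 ]
corollary3p2 p isPrime p%4≡1 =
  subst (λ q → Prime q → F q 0 ≡ 1ℚ [mod q ^ 2 ]) (sym p≡4t+1) (FAtZero.F[0]≡1 t) isPrime
  where
  t : ℕ
  t = p / 4
  p≡4t+1 : p ≡ suc ((t ℕ.+ t) ℕ.+ (t ℕ.+ t))
  p≡4t+1 = trans (m≡m%n+[m/n]*n p 4) (cong₂ ℕ._+_ p%4≡1 (sym (quadruple t)))
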